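{- Let $k$ be a finite field of characteristic $\ell$ and let $G \subset \mathrm{GL}_2(k)$ be a subgroup whose commutator subgroup is $[G,G] = \{\pm 1\}$. If $\ell \neq 2$, then the image $\overline{G}$ of $G$ in $\mathrm{PGL}_2(k)$ is isomorphic to $C_2 \times C_2$. -}

module Defs where

open import Level using (Level; _⊔_; suc)
open import Data.Nat as ℕ using (ℕ; zero; _<_)
open import Data.Bool using (Bool; _xor_)
open import Data.Product using (Σ; ∃; _×_; _,_; proj₁)
open import Data.Sum using (_⊎_)
open import Data.List using (List)
open import Data.List.Membership.Propositional using (_∈_)
open import Relation.Binary.PropositionalEquality using (_≡_; _≢_)
open import Relation.Nullary using (¬_)
open import Algebra.Structures using (IsCommutativeRing)

-- Finite fields (equality of field elements is propositional equality).
-- The inverse is a total function with the convention 0⁻¹ = 0; only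
-- x * x⁻¹ ≡ 1 for x ≢ 0 is required.

record FiniteField (c : Level) : Set (suc c) where
  infixl 7 _*_
  infixl 6 _+_
  field
    Carrier : Set c
    _+_ _*_ : Carrier → Carrier → Carrier
    -_      : Carrier → Carrier
    0# 1#   : Carrier
    _⁻¹     : Carrier → Carrier
    isCommutativeRing : IsCommutativeRing _≡_ _+_ _*_ -_ 0# 1#
    0≢1       : 0# ≢ 1#
    *-inverse : ∀ x → x ≢ 0# → x * (x ⁻¹) ≡ 1#
    elements  : List Carrier
    complete  : ∀ x → x ∈ elements

module _ {c : Level} (k : FiniteField c) where
  open FiniteField k

  _·1 : ℕ → Carrier
  zero ·1 = 0#
  ℕ.suc n ·1 = 1# + (n ·1)

  IsCharacteristic : ℕ → Set c
  IsCharacteristic ℓ = (0 < ℓ) × (ℓ ·1 ≡ 0#) × (∀ m → 0 < m → m < ℓ → m ·1 ≢ 0#)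

  record Mat : Set c where
    constructor mat
    field a b c' d : Carrier
  open Mat public

  _·_ : Mat → Mat → Mat
  mat a₁ b₁ c₁ d₁ · mat a₂ b₂ c₂ d₂ =
    mat (a₁ * a₂ + b₁ * c₂) (a₁ * b₂ + b₁ * d₂)
        (c₁ * a₂ + d₁ * c₂) (c₁ * b₂ + d₁ * d₂)

  det : Mat → Carrier
  det (mat a b c d) = a * d + - (b * c)

  scalar : Carrier → Mat
  scalar x = mat x 0# 0# x

  I : Mat
  I = scalar 1#

  -I : Mat
  -I = scalar (- 1#)

  -- inverse (adjugate divided by determinant); correct on GL₂(k)
  inv : Mat → Mat
  inv (mat a b c d) = let δ = det (mat a b c d) ⁻¹ in
    mat (δ * d) (δ * (- b)) (δ * (- c)) (δ * a)

  InGL₂ : Mat → Set c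
  InGL₂ M = det M ≢ 0#

  record IsSubgroupGL₂ {g : Level} (G : Mat → Set g) : Set (c ⊔ g) where
    field
      ⊆GL₂   : ∀ {M} → G M → InGL₂ M
      one∈   : G I
      mul∈   : ∀ {M N} → G M → G N → G (M · N)
      inv∈   : ∀ {M} → G M → G (inv M)

  -- the commutator subgroup [G,G]: subgroup generated by the
  -- commutators g h g⁻¹ h⁻¹ with g, h ∈ G
  data Commutator {g : Level} (G : Mat → Set g) : Mat → Set (c ⊔ g) where
    comm : ∀ {M N} → G M → G N → Commutator G (((M · N) · inv M) · inv N)
    one  : Commutator G I
    mul  : ∀ {M N} → Commutator G M → Commutator G N → Commutator G (M · N)
    inv' : ∀ {M} → Commutator G M → Commutator G (inv M)

  -- The image of G in PGL₂(k) = GL₂(k)/k^× : elements of G modulo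
  -- nonzero scalars.
  Elem : {g : Level} → (Mat → Set g) → Set (c ⊔ g)
  Elem G = Σ Mat G

  _∼_ : {g : Level} {G : Mat → Set g} → Elem G → Elem G → Set c
  (M , _) ∼ (N , _) = ∃ λ x → (x ≢ 0#) × (M ≡ scalar x · N)

  -- C₂ × C₂ written additively as Bool × Bool with componentwise xor
  _⊕_ : Bool × Bool → Bool × Bool → Bool × Bool
  (x , y) ⊕ (x' , y') = (x xor x') , (y xor y')

  record ImageIsoC₂×C₂ {g : Level} (G : Mat → Set g) (H : IsSubgroupGL₂ G)
         : Set (c ⊔ g) where
    open IsSubgroupGL₂ H
    field
      φ            : Elem G → Bool × Bool
      well-defined : ∀ u v → u ∼ v → φ u ≡ φ v
      injective    : ∀ u v → φ u ≡ φ v → u ∼ v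
      surjective   : ∀ z → ∃ λ u → φ u ≡ z
      homomorphism : ∀ M N (p : G M) (q : G N) →
                     φ ((M · N) , mul∈ p q) ≡ φ (M , p) ⊕ φ (N , q)

{-# OPTIONS --safe #-}
module Submission where

-- Since every commutator of G is ±1, any A, B ∈ G satisfy A B = ε(A,B) B A for a sign
-- ε(A,B) = ±1, which is multiplicative in A and unchanged when A is multiplied by a scalar.
-- As -1 is a product of commutators, some pair g₀, h₀ ∈ G anticommutes, and
-- A ↦ (ε(A,h₀), ε(A,g₀)) is then a homomorphism from the image of G in PGL₂(k) onto C₂ × C₂.
-- It is injective because, as 2 ≠ 0, anticommuting invertible matrices are traceless
-- (tr h = tr (g h g⁻¹) = - tr h), and only scalars commute with two anticommuting
-- traceless invertible matrices.

open import Level using (Level; 0ℓ; _⊔_)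
open import Algebra.Bundles using (CommutativeRing; RawRing)
open import Algebra.Solver.Ring.AlmostCommutativeRing
  using (fromCommutativeRing; _-Raw-AlmostCommutative⟶_; Induced-equivalence)
open import Data.Bool using (Bool; true; false; _xor_)
open import Data.Empty using (⊥-elim)
open import Data.Maybe using (just; nothing)
open import Data.Nat as ℕ using (ℕ; zero; suc; _∸_; z≤n; s≤s)
open import Data.Product using (∃; _×_; _,_; proj₁; proj₂)
open import Data.Product.Properties using (≡-dec)
open import Data.Sum using (_⊎_; inj₁; inj₂)
open import Function.Bundles using (_⇔_; Equivalence)
open import Relation.Binary.Definitions using (WeaklyDecidable)
open import Relation.Binary.PropositionalEquality as ≡ using (_≡_; _≢_)
open import Relation.Nullary using (yes; no)
open import Defs
  using ( FiniteField; IsCharacteristic; Mat; mat; IsSubgroupGL₂; Commutator; comm; one; mul; inv'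
        ; Elem; ImageIsoC₂×C₂)

-- A ring solver for commutative rings without decidable equality. The coefficients are
-- integers, the pair (m , n) standing for m - n; sums and products of pairs are reduced
-- (one component 0), so that comparing pairs decides equality of the integers they denote.
module IntegerCoefficientRingSolver {r ℓ} (R : CommutativeRing r ℓ) where
  open CommutativeRing R
  open import Algebra.Properties.Ring ring
    using (-‿involutive; -0#≈0#; x[y-z]≈xy-xz; [y-z]x≈yx-zx)
  open import Algebra.Properties.AbelianGroup +-abelianGroup
    using (⁻¹-∙-comm; ⁻¹-anti-homo‿-)
  open import Algebra.Properties.CommutativeSemigroup +-commutativeSemigroup
    using (interchange)
  open import Algebra.Properties.Semiring.Mult.TCOptimised semiring
    using (1+×; ×-homo-+; ×1-homo-*)
    renaming (_×_ to _×ᴿ_)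
  open import Relation.Binary.Reasoning.Setoid setoid

  -‿+-interchange : ∀ x y u v → (x + y) - (u + v) ≈ (x - u) + (y - v)
  -‿+-interchange x y u v = begin
    (x + y) - (u + v)      ≈⟨ +-congˡ (⁻¹-∙-comm u v) ⟨
    (x + y) + (- u + - v)  ≈⟨ interchange x y (- u) (- v) ⟩
    (x - u) + (y - v)      ∎

  -‿+-cancelˡ : ∀ z x y → (z + x) - (z + y) ≈ x - y
  -‿+-cancelˡ z x y = begin
    (z + x) - (z + y)    ≈⟨ -‿+-interchange z x z y ⟩
    (z - z) + (x - y)    ≈⟨ +-congʳ (-‿inverseʳ z) ⟩
    0# + (x - y)         ≈⟨ +-identityˡ (x - y) ⟩
    x - y                ∎

  -‿*-expand : ∀ x y u v → (x - y) * (u - v) ≈ (x * u + y * v) - (x * v + y * u)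
  -‿*-expand x y u v = begin
    (x - y) * (u - v)                      ≈⟨ [y-z]x≈yx-zx (u - v) x y ⟩
    x * (u - v) - y * (u - v)              ≈⟨ distrib-both ⟩
    (x * u - x * v) - (y * u - y * v)      ≈⟨ +-congˡ (⁻¹-anti-homo‿- (y * u) (y * v)) ⟩
    (x * u - x * v) + (y * v - y * u)      ≈⟨ -‿+-interchange (x * u) (y * v) (x * v) (y * u) ⟨
    (x * u + y * v) - (x * v + y * u)      ∎
    where
    distrib-both : x * (u - v) - y * (u - v) ≈ (x * u - x * v) - (y * u - y * v)
    distrib-both = +-cong (x[y-z]≈xy-xz x u v) (-‿cong (x[y-z]≈xy-xz y u v))

  reduce : ℕ × ℕ → ℕ × ℕ
  reduce (m , n) = m ∸ n , n ∸ m

  _+ᵈ_ _*ᵈ_ : ℕ × ℕ → ℕ × ℕ → ℕ × ℕ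
  (m , n) +ᵈ (m′ , n′) = reduce (m ℕ.+ m′ , n ℕ.+ n′)
  (m , n) *ᵈ (m′ , n′) = reduce (m ℕ.* m′ ℕ.+ n ℕ.* n′ , m ℕ.* n′ ℕ.+ n ℕ.* m′)

  -ᵈ_ : ℕ × ℕ → ℕ × ℕ
  -ᵈ (m , n) = n , m

  differences : RawRing 0ℓ 0ℓ
  differences = record
    { Carrier = ℕ × ℕ ; _≈_ = _≡_ ; _+_ = _+ᵈ_ ; _*_ = _*ᵈ_ ; -_ = -ᵈ_
    ; 0# = 0 , 0 ; 1# = 1 , 0 }

  ι : ℕ → Carrier
  ι n = n ×ᴿ 1#

  ι-homo-+* : ∀ m m′ n n′ → ι (m ℕ.* m′ ℕ.+ n ℕ.* n′) ≈ ι m * ι m′ + ι n * ι n′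
  ι-homo-+* m m′ n n′ =
    trans (×-homo-+ 1# (m ℕ.* m′) (n ℕ.* n′)) (+-cong (×1-homo-* m m′) (×1-homo-* n n′))

  -- By cases rather than as ι m - ι n, so that the constants (1 , 0), (0 , 1) and (2 , 0)
  -- denote 1#, - 1# and 1# + 1# definitionally.
  ⟦_⟧ : ℕ × ℕ → Carrier
  ⟦ m , zero ⟧ = ι m
  ⟦ zero , n ⟧ = - ι n
  ⟦ suc m , suc n ⟧ = ⟦ m , n ⟧

  ⟦⟧-difference : ∀ m n → ⟦ m , n ⟧ ≈ ι m - ι n
  ⟦⟧-difference m zero = sym (trans (+-congˡ -0#≈0#) (+-identityʳ (ι m)))
  ⟦⟧-difference zero (suc n) = sym (+-identityˡ _)
  ⟦⟧-difference (suc m) (suc n) = begin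
    ⟦ m , n ⟧                  ≈⟨ ⟦⟧-difference m n ⟩
    ι m - ι n                  ≈⟨ -‿+-cancelˡ 1# (ι m) (ι n) ⟨
    (1# + ι m) - (1# + ι n)    ≈⟨ +-cong (1+× m 1#) (-‿cong (1+× n 1#)) ⟨
    ι (suc m) - ι (suc n)      ∎

  ⟦⟧-reduce : ∀ m n → ⟦ reduce (m , n) ⟧ ≈ ⟦ m , n ⟧
  ⟦⟧-reduce zero zero = refl
  ⟦⟧-reduce zero (suc n) = refl
  ⟦⟧-reduce (suc m) zero = refl
  ⟦⟧-reduce (suc m) (suc n) = ⟦⟧-reduce m n

  ⟦⟧-reduce-difference : ∀ m n → ⟦ reduce (m , n) ⟧ ≈ ι m - ι n
  ⟦⟧-reduce-difference m n = trans (⟦⟧-reduce m n) (⟦⟧-difference m n)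

  ⟦⟧-homo-+ : ∀ x y → ⟦ x +ᵈ y ⟧ ≈ ⟦ x ⟧ + ⟦ y ⟧
  ⟦⟧-homo-+ (m , n) (m′ , n′) = begin
    ⟦ reduce (m ℕ.+ m′ , n ℕ.+ n′) ⟧     ≈⟨ ⟦⟧-reduce-difference (m ℕ.+ m′) (n ℕ.+ n′) ⟩
    ι (m ℕ.+ m′) - ι (n ℕ.+ n′)         ≈⟨ +-cong (×-homo-+ 1# m m′) (-‿cong (×-homo-+ 1# n n′)) ⟩
    (ι m + ι m′) - (ι n + ι n′)         ≈⟨ -‿+-interchange (ι m) (ι m′) (ι n) (ι n′) ⟩
    (ι m - ι n) + (ι m′ - ι n′)         ≈⟨ +-cong (⟦⟧-difference m n) (⟦⟧-difference m′ n′) ⟨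
    ⟦ m , n ⟧ + ⟦ m′ , n′ ⟧             ∎

  ⟦⟧-homo-* : ∀ x y → ⟦ x *ᵈ y ⟧ ≈ ⟦ x ⟧ * ⟦ y ⟧
  ⟦⟧-homo-* (m , n) (m′ , n′) = begin
    ⟦ reduce (m ℕ.* m′ ℕ.+ n ℕ.* n′ , m ℕ.* n′ ℕ.+ n ℕ.* m′) ⟧
      ≈⟨ ⟦⟧-reduce-difference (m ℕ.* m′ ℕ.+ n ℕ.* n′) (m ℕ.* n′ ℕ.+ n ℕ.* m′) ⟩
    ι (m ℕ.* m′ ℕ.+ n ℕ.* n′) - ι (m ℕ.* n′ ℕ.+ n ℕ.* m′)
      ≈⟨ +-cong (ι-homo-+* m m′ n n′) (-‿cong (ι-homo-+* m n′ n m′)) ⟩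
    (ι m * ι m′ + ι n * ι n′) - (ι m * ι n′ + ι n * ι m′)
      ≈⟨ -‿*-expand (ι m) (ι n) (ι m′) (ι n′) ⟨
    (ι m - ι n) * (ι m′ - ι n′)
      ≈⟨ *-cong (⟦⟧-difference m n) (⟦⟧-difference m′ n′) ⟨
    ⟦ m , n ⟧ * ⟦ m′ , n′ ⟧
      ∎

  ⟦⟧-‿homo : ∀ x → ⟦ -ᵈ x ⟧ ≈ - ⟦ x ⟧
  ⟦⟧-‿homo (m , n) = begin
    ⟦ n , m ⟧          ≈⟨ ⟦⟧-difference n m ⟩
    ι n - ι m          ≈⟨ ⁻¹-anti-homo‿- (ι m) (ι n) ⟨
    - (ι m - ι n)      ≈⟨ -‿cong (⟦⟧-difference m n) ⟨
    - ⟦ m , n ⟧        ∎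

  differences⟶R : differences -Raw-AlmostCommutative⟶ fromCommutativeRing R
  differences⟶R = record
    { ⟦_⟧ = ⟦_⟧ ; +-homo = ⟦⟧-homo-+ ; *-homo = ⟦⟧-homo-* ; -‿homo = ⟦⟧-‿homo
    ; 0-homo = refl ; 1-homo = refl }

  _≟ᵈ_ : WeaklyDecidable (Induced-equivalence differences⟶R)
  x ≟ᵈ y with ≡-dec ℕ._≟_ ℕ._≟_ x y
  ... | yes ≡.refl = just refl
  ... | no _ = nothing

  open import Algebra.Solver.Ring differences (fromCommutativeRing R) differences⟶R _≟ᵈ_ public
    using (solve; _:=_; _:+_; _:*_; :-_; _:-_; con)


module GL₂ {f} (k : FiniteField f) where
  open FiniteField k
  open ≡ using (refl; sym; trans; cong; cong₂; subst; module ≡-Reasoning)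

  ring : CommutativeRing f f
  ring = record { isCommutativeRing = isCommutativeRing }

  open CommutativeRing ring
    using ( _-_; +-identityʳ; -‿inverseʳ; *-comm; *-assoc; *-identityˡ; *-identityʳ
          ; zeroˡ; zeroʳ; distribˡ; +-group)
  open import Algebra.Properties.Ring (CommutativeRing.ring ring) using (-1*x≈-x; -‿involutive; -0#≈0#)
  open import Algebra.Properties.Group +-group using (x∙y⁻¹≈ε⇒x≈y; inverseʳ-unique)
  open IntegerCoefficientRingSolver ring using (solve; _:=_; _:+_; _:*_; :-_; _:-_; con)
  open ≡-Reasoning

  two : Carrier
  two = 1# + 1#

  x*y≡0⇒y≡0 : ∀ {x y} → x ≢ 0# → x * y ≡ 0# → y ≡ 0#
  x*y≡0⇒y≡0 {x} {y} x≢0 xy≡0 = begin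
    y                  ≡⟨ *-identityˡ y ⟨
    1# * y             ≡⟨ cong (_* y) (trans (*-comm (x ⁻¹) x) (*-inverse x x≢0)) ⟨
    x ⁻¹ * x * y       ≡⟨ *-assoc (x ⁻¹) x y ⟩
    x ⁻¹ * (x * y)     ≡⟨ cong (x ⁻¹ *_) xy≡0 ⟩
    x ⁻¹ * 0#          ≡⟨ zeroʳ (x ⁻¹) ⟩
    0#                 ∎

  1≢0 : 1# ≢ 0#
  1≢0 1≡0 = 0≢1 (sym 1≡0)

  *-≢0 : ∀ {x y} → x ≢ 0# → y ≢ 0# → x * y ≢ 0#
  *-≢0 x≢0 y≢0 xy≡0 = y≢0 (x*y≡0⇒y≡0 x≢0 xy≡0)

  -‿≢0 : ∀ {x} → x ≢ 0# → - x ≢ 0#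
  -‿≢0 {x} x≢0 -x≡0 = x≢0 (trans (sym (-‿involutive x)) (trans (cong -_ -x≡0) -0#≈0#))

  characteristic≢2⇒two≢0 : ∀ {ℓ} → IsCharacteristic k ℓ → ℓ ≢ 2 → two ≢ 0#
  characteristic≢2⇒two≢0 {zero} (() , _)
  characteristic≢2⇒two≢0 {1} (_ , 1+0≡0 , _) _ _ = 1≢0 (trans (sym (+-identityʳ 1#)) 1+0≡0)
  characteristic≢2⇒two≢0 {2} _ ℓ≢2 = ⊥-elim (ℓ≢2 refl)
  characteristic≢2⇒two≢0 {suc (suc (suc _))} (_ , _ , below-ℓ≢0) _ two≡0 =
    below-ℓ≢0 2 (s≤s z≤n) (s≤s (s≤s (s≤s z≤n))) (trans (cong (1# +_) (+-identityʳ 1#)) two≡0)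

  infixl 7 _·_ _⋆_

  _·_ : Mat k → Mat k → Mat k
  _·_ = Defs._·_ k

  det : Mat k → Carrier
  det = Defs.det k

  inv : Mat k → Mat k
  inv = Defs.inv k

  scalar : Carrier → Mat k
  scalar = Defs.scalar k

  I -I : Mat k
  I = Defs.I k
  -I = Defs.-I k

  InGL₂ : Mat k → Set f
  InGL₂ = Defs.InGL₂ k

  tr : Mat k → Carrier
  tr (mat a _ _ d) = a + d

  _⋆_ : Carrier → Mat k → Mat k
  x ⋆ mat a b c d = mat (x * a) (x * b) (x * c) (x * d)

  traceless : Carrier → Carrier → Carrier → Mat k
  traceless a b c = mat a b c (- a)

  mat-cong : ∀ {a b c d a′ b′ c′ d′} → a ≡ a′ → b ≡ b′ → c ≡ c′ → d ≡ d′ →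
             mat {k = k} a b c d ≡ mat a′ b′ c′ d′
  mat-cong refl refl refl refl = refl

  mat-injective : ∀ {a b c d a′ b′ c′ d′} → mat {k = k} a b c d ≡ mat a′ b′ c′ d′ →
                  a ≡ a′ × b ≡ b′ × c ≡ c′ × d ≡ d′
  mat-injective refl = refl , refl , refl , refl

  ·-assoc : ∀ A B C → (A · B) · C ≡ A · (B · C)
  ·-assoc (mat a b c d) (mat a′ b′ c′ d′) (mat a″ b″ c″ d″) =
    mat-cong (row a b a″ c″) (row a b b″ d″) (row c d a″ c″) (row c d b″ d″)
    where
    row : ∀ x y u v → (x * a′ + y * c′) * u + (x * b′ + y * d′) * v ≡
                      x * (a′ * u + b′ * v) + y * (c′ * u + d′ * v)
    row x y u v = solve 8 (λ x y u v a′ b′ c′ d′ →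
      (x :* a′ :+ y :* c′) :* u :+ (x :* b′ :+ y :* d′) :* v :=
      x :* (a′ :* u :+ b′ :* v) :+ y :* (c′ :* u :+ d′ :* v)) refl x y u v a′ b′ c′ d′

  scalar-·ˡ : ∀ x A → scalar x · A ≡ x ⋆ A
  scalar-·ˡ x (mat a b c d) = mat-cong (left a c) (left b d) (right c a) (right d b)
    where
    left : ∀ u v → x * u + 0# * v ≡ x * u
    left u v = solve 3 (λ x u v → x :* u :+ con (0 , 0) :* v := x :* u) refl x u v
    right : ∀ u v → 0# * v + x * u ≡ x * u
    right u v = solve 3 (λ x u v → con (0 , 0) :* v :+ x :* u := x :* u) refl x u v

  scalar-·ʳ : ∀ x A → A · scalar x ≡ x ⋆ A
  scalar-·ʳ x (mat a b c d) = mat-cong (left a b) (right b a) (left c d) (right d c)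
    where
    left : ∀ u v → u * x + v * 0# ≡ x * u
    left u v = solve 3 (λ x u v → u :* x :+ v :* con (0 , 0) := x :* u) refl x u v
    right : ∀ u v → v * 0# + u * x ≡ x * u
    right u v = solve 3 (λ x u v → v :* con (0 , 0) :+ u :* x := x :* u) refl x u v

  scalar-central : ∀ x A → scalar x · A ≡ A · scalar x
  scalar-central x A = trans (scalar-·ˡ x A) (sym (scalar-·ʳ x A))

  ⋆-identity : ∀ A → 1# ⋆ A ≡ A
  ⋆-identity (mat a b c d) = mat-cong (*-identityˡ a) (*-identityˡ b) (*-identityˡ c) (*-identityˡ d)

  ·-identityˡ : ∀ A → I · A ≡ A
  ·-identityˡ A = trans (scalar-·ˡ 1# A) (⋆-identity A)

  ·-identityʳ : ∀ A → A · I ≡ A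
  ·-identityʳ A = trans (scalar-·ʳ 1# A) (⋆-identity A)

  scalar-·-scalar : ∀ x y → scalar x · scalar y ≡ scalar (x * y)
  scalar-·-scalar x y = trans (scalar-·ˡ x (scalar y)) (mat-cong refl (zeroʳ x) (zeroʳ x) refl)

  ·-scalar-slide : ∀ A x B → A · (scalar x · B) ≡ scalar x · (A · B)
  ·-scalar-slide A x B = begin
    A · (scalar x · B)   ≡⟨ ·-assoc A (scalar x) B ⟨
    A · scalar x · B     ≡⟨ cong (_· B) (scalar-central x A) ⟨
    scalar x · A · B     ≡⟨ ·-assoc (scalar x) A B ⟩
    scalar x · (A · B)   ∎

  ·-inverseʳ : ∀ {A} → InGL₂ A → A · inv A ≡ I
  ·-inverseʳ {mat a b c d} det≢0 = mat-cong (trans e₁₁ det*δ≡1) e₁₂ e₂₁ (trans e₂₂ det*δ≡1)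
    where
    δ : Carrier
    δ = det (mat a b c d) ⁻¹
    det*δ≡1 : det (mat a b c d) * δ ≡ 1#
    det*δ≡1 = *-inverse (det (mat a b c d)) det≢0
    e₁₁ : a * (δ * d) + b * (δ * - c) ≡ det (mat a b c d) * δ
    e₁₁ = solve 5 (λ a b c d δ → a :* (δ :* d) :+ b :* (δ :* :- c) := (a :* d :- b :* c) :* δ)
                  refl a b c d δ
    e₁₂ : a * (δ * - b) + b * (δ * a) ≡ 0#
    e₁₂ = solve 3 (λ a b δ → a :* (δ :* :- b) :+ b :* (δ :* a) := con (0 , 0)) refl a b δ
    e₂₁ : c * (δ * d) + d * (δ * - c) ≡ 0#
    e₂₁ = solve 3 (λ c d δ → c :* (δ :* d) :+ d :* (δ :* :- c) := con (0 , 0)) refl c d δ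
    e₂₂ : c * (δ * - b) + d * (δ * a) ≡ det (mat a b c d) * δ
    e₂₂ = solve 5 (λ a b c d δ → c :* (δ :* :- b) :+ d :* (δ :* a) := (a :* d :- b :* c) :* δ)
                  refl a b c d δ

  ·-inverseˡ : ∀ {A} → InGL₂ A → inv A · A ≡ I
  ·-inverseˡ {mat a b c d} det≢0 = mat-cong (trans e₁₁ det*δ≡1) e₁₂ e₂₁ (trans e₂₂ det*δ≡1)
    where
    δ : Carrier
    δ = det (mat a b c d) ⁻¹
    det*δ≡1 : det (mat a b c d) * δ ≡ 1#
    det*δ≡1 = *-inverse (det (mat a b c d)) det≢0
    e₁₁ : δ * d * a + δ * - b * c ≡ det (mat a b c d) * δ
    e₁₁ = solve 5 (λ a b c d δ → δ :* d :* a :+ δ :* :- b :* c := (a :* d :- b :* c) :* δ)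
                  refl a b c d δ
    e₁₂ : δ * d * b + δ * - b * d ≡ 0#
    e₁₂ = solve 3 (λ b d δ → δ :* d :* b :+ δ :* :- b :* d := con (0 , 0)) refl b d δ
    e₂₁ : δ * - c * a + δ * a * c ≡ 0#
    e₂₁ = solve 3 (λ a c δ → δ :* :- c :* a :+ δ :* a :* c := con (0 , 0)) refl a c δ
    e₂₂ : δ * - c * b + δ * a * d ≡ det (mat a b c d) * δ
    e₂₂ = solve 5 (λ a b c d δ → δ :* :- c :* b :+ δ :* a :* d := (a :* d :- b :* c) :* δ)
                  refl a b c d δ

  inv-·-cancel : ∀ {A} → InGL₂ A → ∀ B → inv A · (A · B) ≡ B
  inv-·-cancel {A} A∈ B = begin
    inv A · (A · B)   ≡⟨ ·-assoc (inv A) A B ⟨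
    inv A · A · B     ≡⟨ cong (_· B) (·-inverseˡ A∈) ⟩
    I · B             ≡⟨ ·-identityˡ B ⟩
    B                 ∎

  ·-inv-cancel : ∀ {A} → InGL₂ A → ∀ B → B · A · inv A ≡ B
  ·-inv-cancel {A} A∈ B = begin
    B · A · inv A     ≡⟨ ·-assoc B A (inv A) ⟩
    B · (A · inv A)   ≡⟨ cong (B ·_) (·-inverseʳ A∈) ⟩
    B · I             ≡⟨ ·-identityʳ B ⟩
    B                 ∎

  ·-cancelʳ : ∀ {A} → InGL₂ A → ∀ {B C} → B · A ≡ C · A → B ≡ C
  ·-cancelʳ {A} A∈ {B} {C} BA≡CA = begin
    B                 ≡⟨ ·-inv-cancel A∈ B ⟨
    B · A · inv A     ≡⟨ cong (_· inv A) BA≡CA ⟩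
    C · A · inv A     ≡⟨ ·-inv-cancel A∈ C ⟩
    C                 ∎

  det-I : det I ≡ 1#
  det-I = solve 0 (con (1 , 0) :* con (1 , 0) :- con (0 , 0) :* con (0 , 0) := con (1 , 0)) refl

  det-scalar-0 : det (scalar 0#) ≡ 0#
  det-scalar-0 = solve 0 (con (0 , 0) :* con (0 , 0) :- con (0 , 0) :* con (0 , 0) := con (0 , 0)) refl

  I∈GL₂ : InGL₂ I
  I∈GL₂ det-I≡0 = 1≢0 (trans (sym det-I) det-I≡0)

  inv-I : inv I ≡ I
  inv-I = trans (sym (·-identityˡ (inv I))) (·-inverseʳ I∈GL₂)

  tr-comm : ∀ A B → tr (A · B) ≡ tr (B · A)
  tr-comm (mat a b c d) (mat a′ b′ c′ d′) = solve 8 (λ a b c d a′ b′ c′ d′ →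
    (a :* a′ :+ b :* c′) :+ (c :* b′ :+ d :* d′) := (a′ :* a :+ b′ :* c) :+ (c′ :* b :+ d′ :* d))
    refl a b c d a′ b′ c′ d′

  tr-⋆ : ∀ x A → tr (x ⋆ A) ≡ x * tr A
  tr-⋆ x (mat a b c d) = sym (distribˡ x a d)

  tr-[-I·] : ∀ A → tr (-I · A) ≡ - tr A
  tr-[-I·] A = trans (cong tr (scalar-·ˡ (- 1#) A)) (trans (tr-⋆ (- 1#) A) (-1*x≈-x (tr A)))

  ≡-by-combination : ∀ {x y l₁ r₁ l₂ r₂ l₃ r₃} c₁ c₂ c₃ → l₁ ≡ r₁ → l₂ ≡ r₂ → l₃ ≡ r₃ →
                     x - y ≡ c₁ * (l₁ - r₁) + c₂ * (l₂ - r₂) + c₃ * (l₃ - r₃) → x ≡ y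
  ≡-by-combination {x} {y} {r₁ = r₁} {r₂ = r₂} {r₃ = r₃} c₁ c₂ c₃ refl refl refl x-y≡combination =
    x∙y⁻¹≈ε⇒x≈y x y (trans x-y≡combination (solve 6 (λ c₁ c₂ c₃ r₁ r₂ r₃ →
      c₁ :* (r₁ :- r₁) :+ c₂ :* (r₂ :- r₂) :+ c₃ :* (r₃ :- r₃) := con (0 , 0)) refl c₁ c₂ c₃ r₁ r₂ r₃))

  -- Commuting with the traceless g forces the traceless part of z to be a multiple of g;
  -- this is that fact paired, through the trace form, with an arbitrary traceless matrix.
  centraliser-of-traceless : ∀ {a b c} z → z · traceless a b c ≡ traceless a b c · z → ∀ e f m →
    two * - det (traceless a b c) * tr (z · traceless e f m) ≡
    tr (z · traceless a b c) * tr (traceless a b c · traceless e f m)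
  centraliser-of-traceless {a} {b} {c} (mat p q r s) zg≡gz e f m with mat-injective zg≡gz
  ... | E₁₁ , E₁₂ , E₂₁ , _ =
    ≡-by-combination (two * e * a + m * b - f * c) (two * e * c - m * a) (f * a) E₁₁ E₁₂ E₂₁
      (solve 10 (λ a b c e f m p q r s →
        con (2 , 0) :* :- (a :* :- a :- b :* c) :* ((p :* e :+ q :* m) :+ (r :* f :+ s :* :- e))
          :- ((p :* a :+ q :* c) :+ (r :* b :+ s :* :- a))
             :* ((a :* e :+ b :* m) :+ (c :* f :+ :- a :* :- e))
        := (con (2 , 0) :* e :* a :+ m :* b :- f :* c) :* ((p :* a :+ q :* c) :- (a :* p :+ b :* r))
          :+ (con (2 , 0) :* e :* c :- m :* a) :* ((p :* b :+ q :* :- a) :- (a :* q :+ b :* s))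
          :+ (f :* a) :* ((r :* a :+ s :* c) :- (c :* p :+ :- a :* r)))
        refl a b c e f m p q r s)

  CommuteUpTo : Mat k → Mat k → Mat k → Set f
  CommuteUpTo S A B = A · B ≡ S · (B · A)

  commuteUpTo-I⇒commute : ∀ {A B} → CommuteUpTo I A B → A · B ≡ B · A
  commuteUpTo-I⇒commute {A} {B} AB≡BA = trans AB≡BA (·-identityˡ (B · A))

  commuteUpTo-refl : ∀ A → CommuteUpTo I A A
  commuteUpTo-refl A = sym (·-identityˡ (A · A))

  commuteUpTo-scalar : ∀ x A → CommuteUpTo I (scalar x) A
  commuteUpTo-scalar x A = trans (scalar-central x A) (sym (·-identityˡ (A · scalar x)))

  commuteUpTo-sym : ∀ {S S′ A B} → S′ · S ≡ I → CommuteUpTo S A B → CommuteUpTo S′ B A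
  commuteUpTo-sym {S} {S′} {A} {B} S′S≡I AB≡SBA = begin
    B · A              ≡⟨ ·-identityˡ (B · A) ⟨
    I · (B · A)        ≡⟨ cong (_· (B · A)) S′S≡I ⟨
    S′ · S · (B · A)   ≡⟨ ·-assoc S′ S (B · A) ⟩
    S′ · (S · (B · A)) ≡⟨ cong (S′ ·_) AB≡SBA ⟨
    S′ · (A · B)       ∎

  commuteUpTo-unique : ∀ {S S′ A B} → InGL₂ A → InGL₂ B →
                       CommuteUpTo S A B → CommuteUpTo S′ A B → S ≡ S′
  commuteUpTo-unique {S} {S′} {A} {B} A∈ B∈ AB≡SBA AB≡S′BA =
    ·-cancelʳ B∈ (·-cancelʳ A∈ (begin
      S · B · A        ≡⟨ ·-assoc S B A ⟩
      S · (B · A)      ≡⟨ AB≡SBA ⟨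
      A · B            ≡⟨ AB≡S′BA ⟩
      S′ · (B · A)     ≡⟨ ·-assoc S′ B A ⟨
      S′ · B · A       ∎))

  commuteUpTo-· : ∀ {x y A B C} → CommuteUpTo (scalar x) A C → CommuteUpTo (scalar y) B C →
                  CommuteUpTo (scalar (x * y)) (A · B) C
  commuteUpTo-· {x} {y} {A} {B} {C} AC≡xCA BC≡yCB = begin
    A · B · C                          ≡⟨ ·-assoc A B C ⟩
    A · (B · C)                        ≡⟨ cong (A ·_) BC≡yCB ⟩
    A · (scalar y · (C · B))           ≡⟨ ·-scalar-slide A y (C · B) ⟩
    scalar y · (A · (C · B))           ≡⟨ cong (scalar y ·_) (·-assoc A C B) ⟨
    scalar y · (A · C · B)             ≡⟨ cong (λ X → scalar y · (X · B)) AC≡xCA ⟩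
    scalar y · (scalar x · (C · A) · B) ≡⟨ cong (scalar y ·_) (·-assoc (scalar x) (C · A) B) ⟩
    scalar y · (scalar x · (C · A · B)) ≡⟨ ·-assoc (scalar y) (scalar x) (C · A · B) ⟨
    scalar y · scalar x · (C · A · B)   ≡⟨ cong₂ _·_ yx≡xy (·-assoc C A B) ⟩
    scalar (x * y) · (C · (A · B))     ∎
    where
    yx≡xy : scalar y · scalar x ≡ scalar (x * y)
    yx≡xy = trans (scalar-·-scalar y x) (cong scalar (*-comm y x))

  commuteUpTo-commutator : ∀ {A B} → InGL₂ A → InGL₂ B → CommuteUpTo (A · B · inv A · inv B) A B
  commuteUpTo-commutator {A} {B} A∈ B∈ = sym (begin
    A · B · inv A · inv B · (B · A)    ≡⟨ ·-assoc (A · B · inv A) (inv B) (B · A) ⟩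
    A · B · inv A · (inv B · (B · A))  ≡⟨ cong (A · B · inv A ·_) (inv-·-cancel B∈ A) ⟩
    A · B · inv A · A                  ≡⟨ ·-assoc (A · B) (inv A) A ⟩
    A · B · (inv A · A)                ≡⟨ cong (A · B ·_) (·-inverseˡ A∈) ⟩
    A · B · I                          ≡⟨ ·-identityʳ (A · B) ⟩
    A · B                              ∎)

  IsScalar : Mat k → Set f
  IsScalar z = ∃ λ x → z ≡ scalar x

  sign : Bool → Carrier
  sign false = 1#
  sign true = - 1#

  ±I : Bool → Mat k
  ±I b = scalar (sign b)

  sign-xor : ∀ x y → sign x * sign y ≡ sign (x xor y)
  sign-xor false false = *-identityˡ 1#
  sign-xor false true = *-identityˡ (- 1#)
  sign-xor true false = *-identityʳ (- 1#)
  sign-xor true true = solve 0 (:- con (1 , 0) :* :- con (1 , 0) := con (1 , 0)) refl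

  -I·-I : -I · -I ≡ I
  -I·-I = trans (scalar-·-scalar (- 1#) (- 1#)) (cong scalar (sign-xor true true))

  module _ (two≢0 : two ≢ 0#) where

    x≡-x⇒x≡0 : ∀ {x} → x ≡ - x → x ≡ 0#
    x≡-x⇒x≡0 {x} x≡-x = x*y≡0⇒y≡0 two≢0 (begin
      two * x   ≡⟨ solve 1 (λ x → con (2 , 0) :* x := x :+ x) refl x ⟩
      x + x     ≡⟨ cong (x +_) x≡-x ⟩
      x + - x   ≡⟨ -‿inverseʳ x ⟩
      0#        ∎)

    anticommuting⇒traceless : ∀ {g h} → InGL₂ g → CommuteUpTo -I g h → tr h ≡ 0#
    anticommuting⇒traceless {g} {h} g∈ gh≡-hg = x≡-x⇒x≡0 (begin
      tr h                        ≡⟨ cong tr (inv-·-cancel g∈ h) ⟨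
      tr (inv g · (g · h))        ≡⟨ tr-comm (inv g) (g · h) ⟩
      tr (g · h · inv g)          ≡⟨ cong (λ X → tr (X · inv g)) gh≡-hg ⟩
      tr (-I · (h · g) · inv g)   ≡⟨ cong tr (·-assoc -I (h · g) (inv g)) ⟩
      tr (-I · (h · g · inv g))   ≡⟨ cong (λ X → tr (-I · X)) (·-inv-cancel g∈ h) ⟩
      tr (-I · h)                 ≡⟨ tr-[-I·] h ⟩
      - tr h                      ∎)

    anticommuting⇒tr·≡0 : ∀ {g h} → CommuteUpTo -I g h → tr (g · h) ≡ 0#
    anticommuting⇒tr·≡0 {g} {h} gh≡-hg = x≡-x⇒x≡0 (begin
      tr (g · h)          ≡⟨ cong tr gh≡-hg ⟩
      tr (-I · (h · g))   ≡⟨ tr-[-I·] (h · g) ⟩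
      - tr (h · g)        ≡⟨ cong -_ (tr-comm h g) ⟩
      - tr (g · h)        ∎)

    centraliser-of-traceless-pair : ∀ {a b c d e f m n} z → d ≡ - a → n ≡ - e →
      let g = mat a b c d ; h = mat e f m n in
      InGL₂ g → InGL₂ h → tr (g · h) ≡ 0# → z · g ≡ g · z → z · h ≡ h · z → IsScalar z
    centraliser-of-traceless-pair {a} {b} {c} {_} {e} {f} {m} {_} (mat p q r s) refl refl
                                  g∈ h∈ tr[gh]≡0 zg≡gz zh≡hz =
      p , mat-cong refl q≡0 r≡0 (sym p≡s)
      where
      z : Mat k
      z = mat p q r s
      g h : Mat k
      g = traceless a b c
      h = traceless e f m
      tr[zh]≡0 : tr (z · h) ≡ 0#
      tr[zh]≡0 = x*y≡0⇒y≡0 (*-≢0 two≢0 (-‿≢0 g∈)) (begin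
        two * - det g * tr (z · h)   ≡⟨ centraliser-of-traceless z zg≡gz e f m ⟩
        tr (z · g) * tr (g · h)      ≡⟨ cong (tr (z · g) *_) tr[gh]≡0 ⟩
        tr (z · g) * 0#              ≡⟨ zeroʳ (tr (z · g)) ⟩
        0#                           ∎)
      tr[z·]≡0 : ∀ x y w → tr (z · traceless x y w) ≡ 0#
      tr[z·]≡0 x y w = x*y≡0⇒y≡0 (*-≢0 two≢0 (-‿≢0 h∈)) (begin
        two * - det h * tr (z · traceless x y w)   ≡⟨ centraliser-of-traceless z zh≡hz x y w ⟩
        tr (z · h) * tr (h · traceless x y w)      ≡⟨ cong (_* tr (h · traceless x y w)) tr[zh]≡0 ⟩
        0# * tr (h · traceless x y w)              ≡⟨ zeroˡ (tr (h · traceless x y w)) ⟩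
        0#                                         ∎)
      p≡s : p ≡ s
      p≡s = x∙y⁻¹≈ε⇒x≈y p s (begin
        p - s                              ≡⟨ solve 4 (λ p q r s → p :- s :=
             (p :* con (1 , 0) :+ q :* con (0 , 0)) :+ (r :* con (0 , 0) :+ s :* :- con (1 , 0)))
             refl p q r s ⟩
        tr (z · traceless 1# 0# 0#)        ≡⟨ tr[z·]≡0 1# 0# 0# ⟩
        0#                                 ∎)
      q≡0 : q ≡ 0#
      q≡0 = begin
        q                                  ≡⟨ solve 4 (λ p q r s → q :=
             (p :* con (0 , 0) :+ q :* con (1 , 0)) :+ (r :* con (0 , 0) :+ s :* :- con (0 , 0)))
             refl p q r s ⟩
        tr (z · traceless 0# 0# 1#)        ≡⟨ tr[z·]≡0 0# 0# 1# ⟩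
        0#                                 ∎
      r≡0 : r ≡ 0#
      r≡0 = begin
        r                                  ≡⟨ solve 4 (λ p q r s → r :=
             (p :* con (0 , 0) :+ q :* con (0 , 0)) :+ (r :* con (1 , 0) :+ s :* :- con (0 , 0)))
             refl p q r s ⟩
        tr (z · traceless 0# 1# 0#)        ≡⟨ tr[z·]≡0 0# 1# 0# ⟩
        0#                                 ∎

    centraliser-of-anticommuting-pair : ∀ {g h} z → InGL₂ g → InGL₂ h → CommuteUpTo -I g h →
                                        z · g ≡ g · z → z · h ≡ h · z → IsScalar z
    centraliser-of-anticommuting-pair {mat a b c d} {mat e f m n} z g∈ h∈ gh≡-hg =
      centraliser-of-traceless-pair z (inverseʳ-unique a d tr[g]≡0) (inverseʳ-unique e n tr[h]≡0)
                                    g∈ h∈ (anticommuting⇒tr·≡0 gh≡-hg)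
      where
      tr[g]≡0 : a + d ≡ 0#
      tr[g]≡0 = anticommuting⇒traceless h∈ (commuteUpTo-sym -I·-I gh≡-hg)
      tr[h]≡0 : e + n ≡ 0#
      tr[h]≡0 = anticommuting⇒traceless g∈ gh≡-hg

    I≢-I : I ≢ -I
    I≢-I I≡-I = two≢0 (trans (cong (1# +_) (proj₁ (mat-injective I≡-I))) (-‿inverseʳ 1#))

    ±I-injective : ∀ {x y} → ±I x ≡ ±I y → x ≡ y
    ±I-injective {false} {false} _ = refl
    ±I-injective {false} {true} I≡-I = ⊥-elim (I≢-I I≡-I)
    ±I-injective {true} {false} -I≡I = ⊥-elim (I≢-I (sym -I≡I))
    ±I-injective {true} {true} _ = refl

    module _ {g} {G : Mat k → Set g} (G-subgroup : IsSubgroupGL₂ k G)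
             (commutators-±I : ∀ M → Commutator k G M ⇔ ((M ≡ I) ⊎ (M ≡ -I))) where
      open IsSubgroupGL₂ G-subgroup

      _⊕_ : Bool × Bool → Bool × Bool → Bool × Bool
      _⊕_ = Defs._⊕_ k

      _∼_ : Elem k G → Elem k G → Set f
      _∼_ = Defs._∼_ k

      commutator-sign : ∀ {A B} → G A → G B → ∃ λ b → A · B · inv A · inv B ≡ ±I b
      commutator-sign A∈ B∈ with Equivalence.to (commutators-±I _) (comm A∈ B∈)
      ... | inj₁ [A,B]≡I = false , [A,B]≡I
      ... | inj₂ [A,B]≡-I = true , [A,B]≡-I

      ε : Elem k G → Elem k G → Bool
      ε (_ , A∈) (_ , B∈) = proj₁ (commutator-sign A∈ B∈)

      ε-spec : ∀ u v → CommuteUpTo (±I (ε u v)) (proj₁ u) (proj₁ v)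
      ε-spec (A , A∈) (B , B∈) = subst (λ S → CommuteUpTo S A B) (proj₂ (commutator-sign A∈ B∈))
                                       (commuteUpTo-commutator (⊆GL₂ A∈) (⊆GL₂ B∈))

      ε-unique : ∀ u v {b} → CommuteUpTo (±I b) (proj₁ u) (proj₁ v) → ε u v ≡ b
      ε-unique (A , A∈) (B , B∈) AB≡±BA =
        ±I-injective (commuteUpTo-unique (⊆GL₂ A∈) (⊆GL₂ B∈) (ε-spec (A , A∈) (B , B∈)) AB≡±BA)

      ε-· : ∀ {A B} (A∈ : G A) (B∈ : G B) v → ε (A · B , mul∈ A∈ B∈) v ≡ ε (A , A∈) v xor ε (B , B∈) v
      ε-· {A} {B} A∈ B∈ v = ε-unique (A · B , mul∈ A∈ B∈) v
        (subst (λ s → CommuteUpTo (scalar s) (A · B) (proj₁ v)) (sign-xor (ε (A , A∈) v) (ε (B , B∈) v))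
               (commuteUpTo-· (ε-spec (A , A∈) v) (ε-spec (B , B∈) v)))

      ε-respects-∼ : ∀ {u u′} v → u ∼ u′ → ε u v ≡ ε u′ v
      ε-respects-∼ {u} {u′} v (x , _ , A≡xA′) = ε-unique u v
        (subst (λ X → CommuteUpTo (±I (ε u′ v)) X (proj₁ v)) (sym A≡xA′)
          (subst (λ s → CommuteUpTo (scalar s) (scalar x · proj₁ u′) (proj₁ v))
                 (*-identityˡ (sign (ε u′ v)))
            (commuteUpTo-· (commuteUpTo-scalar x (proj₁ v)) (ε-spec u′ v))))

      ε-refl : ∀ u → ε u u ≡ false
      ε-refl u = ε-unique u u (commuteUpTo-refl (proj₁ u))

      ε-I : ∀ v → ε (I , one∈) v ≡ false
      ε-I v = ε-unique (I , one∈) v (commuteUpTo-scalar 1# (proj₁ v))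

      ε-false⇒commute : ∀ u v → ε u v ≡ false → proj₁ u · proj₁ v ≡ proj₁ v · proj₁ u
      ε-false⇒commute u v ε≡false =
        commuteUpTo-I⇒commute (subst (λ b → CommuteUpTo (±I b) (proj₁ u) (proj₁ v)) ε≡false (ε-spec u v))

      record AnticommutingPair : Set (f ⊔ g) where
        field
          u v : Elem k G
          anticommute : CommuteUpTo -I (proj₁ u) (proj₁ v)

      trivial-or-anticommuting : ∀ {M} → Commutator k G M → M ≡ I ⊎ AnticommutingPair
      trivial-or-anticommuting (comm {A} {B} A∈ B∈) with commutator-sign A∈ B∈
      ... | false , [A,B]≡I = inj₁ [A,B]≡I
      ... | true , [A,B]≡-I = inj₂ (record
        { u = A , A∈ ; v = B , B∈
        ; anticommute = subst (λ S → CommuteUpTo S A B) [A,B]≡-I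
                              (commuteUpTo-commutator (⊆GL₂ A∈) (⊆GL₂ B∈)) })
      trivial-or-anticommuting one = inj₁ refl
      trivial-or-anticommuting (mul M∈[G,G] N∈[G,G])
        with trivial-or-anticommuting M∈[G,G] | trivial-or-anticommuting N∈[G,G]
      ... | inj₂ pair | _ = inj₂ pair
      ... | inj₁ _ | inj₂ pair = inj₂ pair
      ... | inj₁ refl | inj₁ refl = inj₁ (·-identityˡ I)
      trivial-or-anticommuting (inv' M∈[G,G]) with trivial-or-anticommuting M∈[G,G]
      ... | inj₁ refl = inj₁ inv-I
      ... | inj₂ pair = inj₂ pair

      anticommuting-pair : AnticommutingPair
      anticommuting-pair with trivial-or-anticommuting (Equivalence.from (commutators-±I -I) (inj₂ refl))
      ... | inj₁ -I≡I = ⊥-elim (I≢-I (sym -I≡I))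
      ... | inj₂ pair = pair

      module _ (pair : AnticommutingPair) where
        open AnticommutingPair pair renaming (u to g₀; v to h₀)

        φ : Elem k G → Bool × Bool
        φ u = ε u h₀ , ε u g₀

        φ-respects-∼ : ∀ u u′ → u ∼ u′ → φ u ≡ φ u′
        φ-respects-∼ u u′ u∼u′ = cong₂ _,_ (ε-respects-∼ h₀ u∼u′) (ε-respects-∼ g₀ u∼u′)

        φ-homomorphism : ∀ A B (A∈ : G A) (B∈ : G B) → φ (A · B , mul∈ A∈ B∈) ≡ φ (A , A∈) ⊕ φ (B , B∈)
        φ-homomorphism A B A∈ B∈ = cong₂ _,_ (ε-· A∈ B∈ h₀) (ε-· A∈ B∈ g₀)

        φ-I : φ (I , one∈) ≡ (false , false)
        φ-I = cong₂ _,_ (ε-I h₀) (ε-I g₀)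

        φ-g₀ : φ g₀ ≡ (true , false)
        φ-g₀ = cong₂ _,_ (ε-unique g₀ h₀ anticommute) (ε-refl g₀)

        φ-h₀ : φ h₀ ≡ (false , true)
        φ-h₀ = cong₂ _,_ (ε-refl h₀) (ε-unique h₀ g₀ (commuteUpTo-sym -I·-I anticommute))

        φ-surjective : ∀ z → ∃ λ u → φ u ≡ z
        φ-surjective (false , false) = (I , one∈) , φ-I
        φ-surjective (true , false) = g₀ , φ-g₀
        φ-surjective (false , true) = h₀ , φ-h₀
        φ-surjective (true , true) = (proj₁ g₀ · proj₁ h₀ , mul∈ (proj₂ g₀) (proj₂ h₀)) ,
          trans (φ-homomorphism _ _ (proj₂ g₀) (proj₂ h₀)) (cong₂ _⊕_ φ-g₀ φ-h₀)

        φ≡0⇒scalar : ∀ z → φ z ≡ (false , false) → IsScalar (proj₁ z)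
        φ≡0⇒scalar z φz≡0 =
          centraliser-of-anticommuting-pair (proj₁ z) (⊆GL₂ (proj₂ g₀)) (⊆GL₂ (proj₂ h₀)) anticommute (ε-false⇒commute z g₀ (cong proj₂ φz≡0)) (ε-false⇒commute z h₀ (cong proj₁ φz≡0))

        φ-injective : ∀ u v → φ u ≡ φ v → u ∼ v
        φ-injective (A , A∈) (B , B∈) φA≡φB = x , x≢0 , A≡xB
          where
          B⁻¹∈ : G (inv B)
          B⁻¹∈ = inv∈ B∈
          AB⁻¹∈ : G (A · inv B)
          AB⁻¹∈ = mul∈ A∈ B⁻¹∈
          φ[AB⁻¹]≡0 : φ (A · inv B , AB⁻¹∈) ≡ (false , false)
          φ[AB⁻¹]≡0 = begin
            φ (A · inv B , AB⁻¹∈)                 ≡⟨ φ-homomorphism A (inv B) A∈ B⁻¹∈ ⟩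
            φ (A , A∈) ⊕ φ (inv B , B⁻¹∈)          ≡⟨ cong (_⊕ φ (inv B , B⁻¹∈)) φA≡φB ⟩
            φ (B , B∈) ⊕ φ (inv B , B⁻¹∈)          ≡⟨ φ-homomorphism B (inv B) B∈ B⁻¹∈ ⟨
            φ (B · inv B , mul∈ B∈ B⁻¹∈)           ≡⟨ φ-respects-∼ _ (I , one∈) (1# , 1≢0 , BB⁻¹≡1I) ⟩
            φ (I , one∈)                          ≡⟨ φ-I ⟩
            (false , false)                       ∎
            where
            BB⁻¹≡1I : B · inv B ≡ scalar 1# · I
            BB⁻¹≡1I = trans (·-inverseʳ (⊆GL₂ B∈)) (sym (·-identityˡ I))
          x : Carrier
          x = proj₁ (φ≡0⇒scalar (A · inv B , AB⁻¹∈) φ[AB⁻¹]≡0)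
          AB⁻¹≡x : A · inv B ≡ scalar x
          AB⁻¹≡x = proj₂ (φ≡0⇒scalar (A · inv B , AB⁻¹∈) φ[AB⁻¹]≡0)
          x≢0 : x ≢ 0#
          x≢0 x≡0 = ⊆GL₂ AB⁻¹∈ (trans (cong det (trans AB⁻¹≡x (cong scalar x≡0))) det-scalar-0)
          A≡xB : A ≡ scalar x · B
          A≡xB = begin
            A                    ≡⟨ ·-identityʳ A ⟨
            A · I                ≡⟨ cong (A ·_) (·-inverseˡ (⊆GL₂ B∈)) ⟨
            A · (inv B · B)      ≡⟨ ·-assoc A (inv B) B ⟨
            A · inv B · B        ≡⟨ cong (_· B) AB⁻¹≡x ⟩
            scalar x · B         ∎

        image≅C₂×C₂ : ImageIsoC₂×C₂ k G G-subgroup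
        image≅C₂×C₂ = record
          { φ = φ
          ; well-defined = φ-respects-∼
          ; injective = φ-injective
          ; surjective = φ-surjective
          ; homomorphism = φ-homomorphism
          }


open Defs using (I; -I)

proposition2p9 : ∀ {c g : Level} (k : FiniteField c) (ℓ : ℕ) → IsCharacteristic k ℓ →
                 (G : Mat k → Set g) (H : IsSubgroupGL₂ k G) →
                 (∀ M → Commutator k G M ⇔ ((M ≡ I k) ⊎ (M ≡ -I k))) →
                 ℓ ≢ 2 →
                 ImageIsoC₂×C₂ k G H
proposition2p9 k ℓ ℓ-is-char G G-subgroup commutators-±I ℓ≢2 =
  image≅C₂×C₂ two≢0 G-subgroup commutators-±I (anticommuting-pair two≢0 G-subgroup commutators-±I)
  where
  open GL₂ k
  two≢0 : two ≢ FiniteField.0# k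
  two≢0 = characteristic≢2⇒two≢0 ℓ-is-char ℓ≢2
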